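{- For every $n\ge1$ the map $\Psi_n:\mathcal{D}_{\mathcal{L}_n}\to\mathcal{L}_{n+1}$, $\Psi_n(S,-1)=S$, $\Psi_n(S,1)=S\cup\{n+1\}$, is an isomorphism of posets.
   Context: Let $[k,n]=\{k,\dots,n\}$. $\mathcal{L}_n$ is the set of subsets of $\{1,\dots,n\}$ with $I\le_n J$ iff $\#(I\cap[k,n])\le\#(J\cap[k,n])$ for all $k=1,\dots,n$. Let $\mathcal{L}_n^+=\{S\in\mathcal{L}_n: n\in S\}$ and, for $S\in\mathcal{L}_n^+$, $\delta_n(S)=S\setminus\{n\}$. The double $\mathcal{D}_{\mathcal{L}_n}$ is the set $\mathcal{L}_n\times\{ -1,1\}$ with the partial order: $(S_0,\epsilon_0)\preceq(S_1,\epsilon_1)$ iff either $\epsilon_0=\epsilon_1$ and $S_0\le_nS_1$, or $\epsilon_0=-1$, $\epsilon_1=1$ and there exists $U\in\mathcal{L}_n^+$ with $S_0\le_nU$ and $\delta_n(U)\le_nS_1$. -}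

module Defs where

open import Data.Nat using (ℕ; suc; _≤_; _≤ᵇ_; _≡ᵇ_)
open import Data.Bool using (Bool; true; false; not)
open import Data.Fin using (Fin; toℕ)
open import Data.Fin.Subset using (Subset; _∩_; ∣_∣; _∈_)
open import Data.Vec using (tabulate; _∷ʳ_)
open import Data.Sign using (Sign; -; +)
open import Data.Product using (Σ; _×_; _,_)
open import Data.Empty using (⊥)
open import Data.Sum using (_⊎_)
open import Relation.Binary.PropositionalEquality using (_≡_)

-- A subset of {1,…,n} is a 'Subset n' (= Vec Bool n); index i : Fin n
-- represents the element toℕ i + 1.

interval : (n : ℕ) → ℕ → Subset n
interval n k = tabulate (λ i → k ≤ᵇ suc (toℕ i))

count : (n : ℕ) → ℕ → Subset n → ℕ
count n k I = ∣ I ∩ interval n k ∣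

Leq : (n : ℕ) → Subset n → Subset n → Set
Leq n I J = (k : ℕ) → 1 ≤ k → k ≤ n → count n k I ≤ count n k J

InPlus : (n : ℕ) → Subset n → Set
InPlus n S = Σ (Fin n) (λ i → (suc (toℕ i) ≡ n) × (i ∈ S))

δ : (n : ℕ) → Subset n → Subset n
δ n S = S ∩ tabulate (λ i → not (suc (toℕ i) ≡ᵇ n))

-- The double D_{L_n} = L_n × {-1,1}; sign '-' is -1, '+' is 1.
Double : ℕ → Set
Double n = Subset n × Sign

DLeq : (n : ℕ) → Double n → Double n → Set
DLeq n (S₀ , - ) (S₁ , - ) = Leq n S₀ S₁
DLeq n (S₀ , + ) (S₁ , + ) = Leq n S₀ S₁
DLeq n (S₀ , - ) (S₁ , + ) =
  Σ (Subset n) (λ U → InPlus n U × Leq n S₀ U × Leq n (δ n U) S₁)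
DLeq n (S₀ , + ) (S₁ , - ) = ⊥

-- Ψ_n(S,-1) = S,  Ψ_n(S,1) = S ∪ {n+1}  (element n+1 is the last index of Subset (suc n)).
Ψ : (n : ℕ) → Double n → Subset (suc n)
Ψ n (S , -) = S ∷ʳ false
Ψ n (S , +) = S ∷ʳ true

module Submission where

-- A subset of {1,…,n+1} is a subset S of {1,…,n} together
-- with a top bit a saying whether n+1 belongs to it, and Ψ_n is exactly
-- the map (S , ∓1) ↦ S ∷ʳ a; so Ψ_n is a bijection by the snoc view of
-- vectors.  For the order, the count of S ∷ʳ a on [k,n+1] is the count of
-- S on [k,n] plus a, and on [n+1,n+1] it is just a.  Hence comparing
-- S ∷ʳ a with T ∷ʳ b in L_{n+1} means a ≤ b together with
-- #(S∩[k,n]) + a ≤ #(T∩[k,n]) + b for k ≤ n.  Equal top bits give ≤_n,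
-- top bits (1,0) are never comparable, and top bits (0,1) give the
-- slackened comparison #(S∩[k,n]) ≤ #(T∩[k,n]) + 1.  The remaining work
-- is to show that (S,-1) ⪯ (T,1) in the double is equivalent to that
-- slackened comparison: one direction uses #(U∩[k,n]) = #(δU∩[k,n]) + 1
-- for U ∈ L_n^+, the other takes for U the set obtained from S by
-- removing its largest element and adding n.

open import Defs
open import Data.Nat using (ℕ; zero; suc; _≤_; _∸_; _≤ᵇ_; _≡ᵇ_; z≤n; s≤s)
open import Data.Nat.Properties
  using (≤-refl; ≤-trans; ≤-pred; ≤ᵇ⇒≤; m≤n⇒m≤1+n; m≤n⇒m<n∨m≡n; <⇒≱; <⇒≢; m≤n+m∸n;
         m≤n+o⇒m∸n≤o; m+[n∸m]≡n; suc-injective; _≤?_; _≟_; module ≤-Reasoning)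
open import Data.Bool using (Bool; true; false; not; _∧_; _∨_)
open import Data.Bool.Properties using (∧-identityʳ; ∧-zeroʳ; ∧-conicalʳ; T-≡)
open import Data.Fin using (Fin; toℕ; inject₁; fromℕ; zero; suc)
open import Data.Fin.Properties using (toℕ<n; toℕ-inject₁; toℕ-fromℕ)
open import Data.Fin.Subset using (Subset; _∩_; ∣_∣; _∈_; ⊥)
open import Data.Fin.Subset.Properties using (∩-zeroʳ; ∩-identityʳ; ∣⊥∣≡0)
open import Data.Vec using ([]; _∷_; _∷ʳ_; tabulate; replicate; initLast; here; there)
open import Data.Vec.Properties using (tabulate-cong; ∷ʳ-injective)
open import Data.Sign using () renaming (- to neg; + to pos)
open import Data.Product using (Σ; _×_; _,_; proj₁; proj₂)
open import Data.Sum using (inj₁; inj₂)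
open import Function using (_∘_)
open import Function.Definitions using (Bijective)
open import Function.Bundles using (_⇔_; mk⇔; Equivalence)
open import Function.Construct.Symmetry using (⇔-sym)
open import Function.Construct.Composition using (_⇔-∘_)
open import Data.Empty using (⊥-elim)
open import Relation.Nullary using (¬_)
open import Relation.Nullary.Decidable using (dec-true; dec-false)
open import Relation.Binary.PropositionalEquality
  using (_≡_; refl; sym; trans; cong; cong₂; subst; subst₂; module ≡-Reasoning)

infixl 6 _+ᵇ_
_+ᵇ_ : ℕ → Bool → ℕ
c +ᵇ true  = suc c
c +ᵇ false = c

tabulate-∷ʳ : ∀ {A : Set} {n} (f : Fin (suc n) → A) →
  tabulate f ≡ tabulate (f ∘ inject₁) ∷ʳ f (fromℕ n)
tabulate-∷ʳ {n = zero}  f = refl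
tabulate-∷ʳ {n = suc n} f = cong (f zero ∷_) (tabulate-∷ʳ (f ∘ suc))

tabulate-const : ∀ {A : Set} {n} {x : A} (f : Fin n → A) → (∀ i → f i ≡ x) →
  tabulate f ≡ replicate n x
tabulate-const {n = zero}  f f≡x = refl
tabulate-const {n = suc n} f f≡x = cong₂ _∷_ (f≡x zero) (tabulate-const (f ∘ suc) (f≡x ∘ suc))

∩-∷ʳ : ∀ {n} (s t : Subset n) (a b : Bool) → (s ∷ʳ a) ∩ (t ∷ʳ b) ≡ (s ∩ t) ∷ʳ (a ∧ b)
∩-∷ʳ []      []      a b = refl
∩-∷ʳ (x ∷ s) (y ∷ t) a b = cong (x ∧ y ∷_) (∩-∷ʳ s t a b)

∣∣-∷ʳ : ∀ {n} (s : Subset n) (a : Bool) → ∣ s ∷ʳ a ∣ ≡ ∣ s ∣ +ᵇ a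
∣∣-∷ʳ []          true  = refl
∣∣-∷ʳ []          false = refl
∣∣-∷ʳ (true ∷ s)  true  = cong suc (∣∣-∷ʳ s true)
∣∣-∷ʳ (true ∷ s)  false = cong suc (∣∣-∷ʳ s false)
∣∣-∷ʳ (false ∷ s) a     = ∣∣-∷ʳ s a

interval-∷ʳ : ∀ n k → interval (suc n) k ≡ interval n k ∷ʳ (k ≤ᵇ suc n)
interval-∷ʳ n k = trans (tabulate-∷ʳ (λ i → k ≤ᵇ suc (toℕ i)))
  (cong₂ _∷ʳ_ (tabulate-cong (λ i → cong (λ t → k ≤ᵇ suc t) (toℕ-inject₁ i)))
              (cong (λ t → k ≤ᵇ suc t) (toℕ-fromℕ n)))

interval-beyond : ∀ n → interval n (suc n) ≡ ⊥
interval-beyond n = tabulate-const _ λ i →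
  dec-false (suc n ≤? suc (toℕ i)) (λ n<i+1 → <⇒≱ (toℕ<n i) (≤-pred n<i+1))

count-∷ʳ : ∀ {n k} (s : Subset n) (a : Bool) → k ≤ suc n →
  count (suc n) k (s ∷ʳ a) ≡ count n k s +ᵇ a
count-∷ʳ {n} {k} s a k≤n+1 = begin
  ∣ (s ∷ʳ a) ∩ interval (suc n) k ∣                  ≡⟨ cong (λ I → ∣ (s ∷ʳ a) ∩ I ∣) (interval-∷ʳ n k) ⟩
  ∣ (s ∷ʳ a) ∩ (interval n k ∷ʳ (k ≤ᵇ suc n)) ∣      ≡⟨ cong ∣_∣ (∩-∷ʳ s (interval n k) a _) ⟩
  ∣ (s ∩ interval n k) ∷ʳ (a ∧ (k ≤ᵇ suc n)) ∣        ≡⟨ ∣∣-∷ʳ (s ∩ interval n k) _ ⟩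
  count n k s +ᵇ (a ∧ (k ≤ᵇ suc n))                  ≡⟨ cong (λ t → count n k s +ᵇ (a ∧ t)) (dec-true (k ≤? suc n) k≤n+1) ⟩
  count n k s +ᵇ (a ∧ true)                          ≡⟨ cong (count n k s +ᵇ_) (∧-identityʳ a) ⟩
  count n k s +ᵇ a                                   ∎
  where open ≡-Reasoning

count-beyond : ∀ n (s : Subset n) → count n (suc n) s ≡ 0
count-beyond n s = begin
  ∣ s ∩ interval n (suc n) ∣  ≡⟨ cong (λ I → ∣ s ∩ I ∣) (interval-beyond n) ⟩
  ∣ s ∩ ⊥ ∣                   ≡⟨ cong ∣_∣ (∩-zeroʳ s) ⟩
  ∣ ⊥ {n} ∣                   ≡⟨ ∣⊥∣≡0 n ⟩
  0                           ∎
  where open ≡-Reasoning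

count-top : ∀ {n} (s : Subset n) (a : Bool) → count (suc n) (suc n) (s ∷ʳ a) ≡ 0 +ᵇ a
count-top {n} s a = trans (count-∷ʳ s a ≤-refl) (cong (_+ᵇ a) (count-beyond n s))

-- The comparison of S ∷ʳ a with T ∷ʳ b split into the top interval
-- [n+1,n+1] (only the top bits) and the intervals [k,n+1] with k ≤ n
-- (counts of S and T on [k,n] shifted by the top bits).
SplitLeq : (n : ℕ) → Subset n → Bool → Subset n → Bool → Set
SplitLeq n S a T b =
  (0 +ᵇ a ≤ 0 +ᵇ b) × (∀ k → 1 ≤ k → k ≤ n → count n k S +ᵇ a ≤ count n k T +ᵇ b)

Leq-∷ʳ : ∀ {n} (S T : Subset n) (a b : Bool) →
  Leq (suc n) (S ∷ʳ a) (T ∷ʳ b) ⇔ SplitLeq n S a T b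
Leq-∷ʳ {n} S T a b = mk⇔ split join
  where
  split : Leq (suc n) (S ∷ʳ a) (T ∷ʳ b) → SplitLeq n S a T b
  split S≤T = subst₂ _≤_ (count-top S a) (count-top T b) (S≤T (suc n) (s≤s z≤n) ≤-refl)
            , λ k 1≤k k≤n → let k≤n+1 = m≤n⇒m≤1+n k≤n in
                subst₂ _≤_ (count-∷ʳ S a k≤n+1) (count-∷ʳ T b k≤n+1) (S≤T k 1≤k k≤n+1)
  join : SplitLeq n S a T b → Leq (suc n) (S ∷ʳ a) (T ∷ʳ b)
  join (top , below) k 1≤k k≤n+1 with m≤n⇒m<n∨m≡n k≤n+1
  ... | inj₁ k<n+1 = subst₂ _≤_ (sym (count-∷ʳ S a k≤n+1)) (sym (count-∷ʳ T b k≤n+1))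
                       (below k 1≤k (≤-pred k<n+1))
  ... | inj₂ refl  = subst₂ _≤_ (sym (count-top S a)) (sym (count-top T b)) top

+ᵇ-cancelʳ-≤ : ∀ {c d} a → c +ᵇ a ≤ d +ᵇ a → c ≤ d
+ᵇ-cancelʳ-≤ true  = ≤-pred
+ᵇ-cancelʳ-≤ false = λ c≤d → c≤d

+ᵇ-monoˡ-≤ : ∀ {c d} a → c ≤ d → c +ᵇ a ≤ d +ᵇ a
+ᵇ-monoˡ-≤ true  = s≤s
+ᵇ-monoˡ-≤ false = λ c≤d → c≤d

Leq-∷ʳ-same : ∀ {n} (S T : Subset n) (a : Bool) →
  Leq (suc n) (S ∷ʳ a) (T ∷ʳ a) ⇔ Leq n S T
Leq-∷ʳ-same S T a = mk⇔
  (λ S≤T k 1≤k k≤n → +ᵇ-cancelʳ-≤ a (proj₂ (Equivalence.to (Leq-∷ʳ S T a a) S≤T) k 1≤k k≤n))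
  (λ S≤T → Equivalence.from (Leq-∷ʳ S T a a)
             (≤-refl , λ k 1≤k k≤n → +ᵇ-monoˡ-≤ a (S≤T k 1≤k k≤n)))

Leq-∷ʳ-true-false : ∀ {n} (S T : Subset n) → ¬ Leq (suc n) (S ∷ʳ true) (T ∷ʳ false)
Leq-∷ʳ-true-false S T S≤T with proj₁ (Equivalence.to (Leq-∷ʳ S T true false) S≤T)
... | ()

Leq₊₁ : (n : ℕ) → Subset n → Subset n → Set
Leq₊₁ n I J = (k : ℕ) → 1 ≤ k → k ≤ n → count n k I ≤ suc (count n k J)

Leq-∷ʳ-false-true : ∀ {n} (S T : Subset n) →
  Leq (suc n) (S ∷ʳ false) (T ∷ʳ true) ⇔ Leq₊₁ n S T
Leq-∷ʳ-false-true S T = mk⇔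
  (proj₂ ∘ Equivalence.to (Leq-∷ʳ S T false true))
  (λ S≤T+1 → Equivalence.from (Leq-∷ʳ S T false true) (z≤n , S≤T+1))

δ-∷ʳ : ∀ m (s : Subset m) (a : Bool) → δ (suc m) (s ∷ʳ a) ≡ s ∷ʳ false
δ-∷ʳ m s a = begin
  (s ∷ʳ a) ∩ tabulate keep                                ≡⟨ cong ((s ∷ʳ a) ∩_) (tabulate-∷ʳ keep) ⟩
  (s ∷ʳ a) ∩ (tabulate (keep ∘ inject₁) ∷ʳ keep (fromℕ m)) ≡⟨ ∩-∷ʳ s _ a _ ⟩
  (s ∩ tabulate (keep ∘ inject₁)) ∷ʳ (a ∧ keep (fromℕ m))  ≡⟨ cong₂ _∷ʳ_ lower-kept top-dropped ⟩
  s ∷ʳ false                                              ∎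
  where
  open ≡-Reasoning
  keep : Fin (suc m) → Bool
  keep i = not (suc (toℕ i) ≡ᵇ suc m)
  lower-kept : s ∩ tabulate (keep ∘ inject₁) ≡ s
  lower-kept = trans (cong (s ∩_) (tabulate-const _ λ i → cong not (dec-false (_ ≟ _)
                 λ i+1≡m+1 → <⇒≢ (toℕ<n i) (trans (sym (toℕ-inject₁ i)) (suc-injective i+1≡m+1)))))
               (∩-identityʳ s)
  top-dropped : a ∧ keep (fromℕ m) ≡ false
  top-dropped = trans (cong (λ t → a ∧ not t) (dec-true (_ ≟ _) (cong suc (toℕ-fromℕ m))))
                      (∧-zeroʳ a)

∷ʳ-top-∈ : ∀ {m} (s : Subset m) (a : Bool) (i : Fin (suc m)) →
  toℕ i ≡ m → i ∈ (s ∷ʳ a) → a ≡ true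
∷ʳ-top-∈ []      a zero    _   here      = refl
∷ʳ-top-∈ (x ∷ s) a (suc i) i≡m (there p) = ∷ʳ-top-∈ s a i (suc-injective i≡m) p

top-∈-∷ʳ : ∀ {m} (s : Subset m) → fromℕ m ∈ (s ∷ʳ true)
top-∈-∷ʳ []      = here
top-∈-∷ʳ (x ∷ s) = there (top-∈-∷ʳ s)

InPlus-∷ʳ : ∀ m (s : Subset m) (a : Bool) → InPlus (suc m) (s ∷ʳ a) → a ≡ true
InPlus-∷ʳ m s a (i , i+1≡m+1 , i∈) = ∷ʳ-top-∈ s a i (suc-injective i+1≡m+1) i∈

∷ʳ-InPlus : ∀ m (s : Subset m) → InPlus (suc m) (s ∷ʳ true)
∷ʳ-InPlus m s = fromℕ m , cong suc (toℕ-fromℕ m) , top-∈-∷ʳ s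

count-δ : ∀ m (U : Subset (suc m)) → InPlus (suc m) U → ∀ {k} → k ≤ suc m →
  count (suc m) k U ≡ suc (count (suc m) k (δ (suc m) U))
count-δ m U U⁺ {k} k≤ with initLast U
... | u , a , refl with InPlus-∷ʳ m u a U⁺
... | refl = begin
  count (suc m) k (u ∷ʳ true)            ≡⟨ count-∷ʳ u true k≤ ⟩
  suc (count m k u)                      ≡⟨ cong suc (count-∷ʳ u false k≤) ⟨
  suc (count (suc m) k (u ∷ʳ false))     ≡⟨ cong (suc ∘ count (suc m) k) (δ-∷ʳ m u true) ⟨
  suc (count (suc m) k (δ (suc m) (u ∷ʳ true))) ∎
  where open ≡-Reasoning

nonempty : ∀ {n} → Subset n → Bool
nonempty []      = false
nonempty (x ∷ s) = x ∨ nonempty s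

dropMax : ∀ {n} → Subset n → Subset n
dropMax []      = []
dropMax (x ∷ s) with nonempty s
... | true  = x ∷ dropMax s
... | false = false ∷ s

UpwardClosed : ∀ {n} → (Fin n → Bool) → Set
UpwardClosed f = ∀ i j → toℕ i ≤ toℕ j → f i ≡ true → f j ≡ true

empty-∩ : ∀ {n} (s t : Subset n) → nonempty s ≡ false → ∣ s ∩ t ∣ ≡ 0
empty-∩ []          []      _       = refl
empty-∩ (false ∷ s) (y ∷ t) s-empty = empty-∩ s t s-empty

nonempty-∣∣ : ∀ {n} (s : Subset n) → nonempty s ≡ true → 1 ≤ ∣ s ∣
nonempty-∣∣ (true ∷ s)  _          = s≤s z≤n
nonempty-∣∣ (false ∷ s) s-nonempty = nonempty-∣∣ s s-nonempty

upward-tail : ∀ {n} {f : Fin (suc n) → Bool} → UpwardClosed f → UpwardClosed (f ∘ suc)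
upward-tail up i j i≤j = up (suc i) (suc j) (s≤s i≤j)

dropMax-count : ∀ {n} (s : Subset n) (f : Fin n → Bool) → UpwardClosed f →
  ∣ dropMax s ∩ tabulate f ∣ ≡ ∣ s ∩ tabulate f ∣ ∸ 1
dropMax-count []      f up = refl
dropMax-count (x ∷ s) f up with nonempty s in ne
... | false with x ∧ f zero
...   | false rewrite empty-∩ s (tabulate (f ∘ suc)) ne = refl
...   | true  = refl
dropMax-count (x ∷ s) f up | true with x ∧ f zero in hit
...   | false = dropMax-count s (f ∘ suc) (upward-tail up)
...   | true  = trans (cong suc (dropMax-count s (f ∘ suc) (upward-tail up))) (m+[n∸m]≡n occupied)
  where
  -- x is counted, so by upward closure the mask is full on the tail.
  tail-full : s ∩ tabulate (f ∘ suc) ≡ s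
  tail-full = trans (cong (s ∩_) (tabulate-const (f ∘ suc)
                λ i → up zero (suc i) z≤n (∧-conicalʳ x (f zero) hit)))
              (∩-identityʳ s)
  occupied : 1 ≤ ∣ s ∩ tabulate (f ∘ suc) ∣
  occupied = subst (1 ≤_) (cong ∣_∣ (sym tail-full)) (nonempty-∣∣ s ne)

interval-upward : ∀ n k → UpwardClosed {n} (λ i → k ≤ᵇ suc (toℕ i))
interval-upward n k i j i≤j k≤i+1 =
  dec-true (k ≤? suc (toℕ j)) (≤-trans (≤ᵇ⇒≤ k (suc (toℕ i)) (Equivalence.from T-≡ k≤i+1)) (s≤s i≤j))

count-dropMax : ∀ {n} k (s : Subset n) → count n k (dropMax s) ≡ count n k s ∸ 1
count-dropMax {n} k s = dropMax-count s _ (interval-upward n k)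

-- The witness for (S,-1) ⪯ (T,1) where S = s ∷ʳ b: the set S with its
-- largest element removed, restricted to {1,…,m} (n+1 is added back later).
demote : ∀ {m} → Subset m → Bool → Subset m
demote s true  = s
demote s false = dropMax s

count-demote : ∀ {m} k (s : Subset m) (b : Bool) →
  count m k (demote s b) ≡ (count m k s +ᵇ b) ∸ 1
count-demote k s true  = refl
count-demote k s false = count-dropMax k s

DLeq-mixed : ∀ m (S T : Subset (suc m)) → DLeq (suc m) (S , neg) (T , pos) ⇔ Leq₊₁ (suc m) S T
DLeq-mixed m S T = mk⇔ necessary sufficient
  where
  n = suc m
  necessary : DLeq n (S , neg) (T , pos) → Leq₊₁ n S T
  necessary (U , U⁺ , S≤U , δU≤T) k 1≤k k≤n = begin
    count n k S                  ≤⟨ S≤U k 1≤k k≤n ⟩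
    count n k U                  ≡⟨ count-δ m U U⁺ k≤n ⟩
    suc (count n k (δ n U))      ≤⟨ s≤s (δU≤T k 1≤k k≤n) ⟩
    suc (count n k T)            ∎
    where open ≤-Reasoning
  sufficient : Leq₊₁ n S T → DLeq n (S , neg) (T , pos)
  sufficient S≤T+1 with initLast S
  ... | s , b , refl = demote s b ∷ʳ true , ∷ʳ-InPlus m (demote s b) , S≤U , δU≤T
    where
    c : ℕ → ℕ
    c k = count m k s +ᵇ b
    S≤U : Leq n (s ∷ʳ b) (demote s b ∷ʳ true)
    S≤U k 1≤k k≤n = begin
      count n k (s ∷ʳ b)               ≡⟨ count-∷ʳ s b k≤n ⟩
      c k                              ≤⟨ m≤n+m∸n (c k) 1 ⟩
      suc (c k ∸ 1)                    ≡⟨ cong suc (count-demote k s b) ⟨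
      suc (count m k (demote s b))     ≡⟨ count-∷ʳ (demote s b) true k≤n ⟨
      count n k (demote s b ∷ʳ true)   ∎
      where open ≤-Reasoning
    δU≤T : Leq n (δ n (demote s b ∷ʳ true)) T
    δU≤T k 1≤k k≤n = begin
      count n k (δ n (demote s b ∷ʳ true))  ≡⟨ cong (count n k) (δ-∷ʳ m (demote s b) true) ⟩
      count n k (demote s b ∷ʳ false)       ≡⟨ count-∷ʳ (demote s b) false k≤n ⟩
      count m k (demote s b)                ≡⟨ count-demote k s b ⟩
      c k ∸ 1                               ≤⟨ m≤n+o⇒m∸n≤o (c k) 1 c≤T+1 ⟩
      count n k T                           ∎
      where
      open ≤-Reasoning
      c≤T+1 : c k ≤ suc (count n k T)
      c≤T+1 = subst (_≤ suc (count n k T)) (count-∷ʳ s b k≤n) (S≤T+1 k 1≤k k≤n)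

-- Ψ_n is a bijection: every subset of {1,…,n+1} is uniquely s ∷ʳ a.
Ψ-bijective : ∀ n → Bijective {A = Double n} _≡_ _≡_ (Ψ n)
Ψ-bijective n = injective , surjective
  where
  injective : ∀ {x y} → Ψ n x ≡ Ψ n y → x ≡ y
  injective {S , neg} {T , neg} Ψx≡Ψy = cong (_, neg) (proj₁ (∷ʳ-injective S T Ψx≡Ψy))
  injective {S , pos} {T , pos} Ψx≡Ψy = cong (_, pos) (proj₁ (∷ʳ-injective S T Ψx≡Ψy))
  injective {S , neg} {T , pos} Ψx≡Ψy with () ← proj₂ (∷ʳ-injective S T Ψx≡Ψy)
  injective {S , pos} {T , neg} Ψx≡Ψy with () ← proj₂ (∷ʳ-injective S T Ψx≡Ψy)
  surjective : ∀ y → Σ (Double n) λ x → ∀ {z} → z ≡ x → Ψ n z ≡ y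
  surjective y with initLast y
  ... | s , true  , refl = (s , pos) , λ { refl → refl }
  ... | s , false , refl = (s , neg) , λ { refl → refl }

Ψ-order : ∀ m (x y : Double (suc m)) →
  DLeq (suc m) x y ⇔ Leq (suc (suc m)) (Ψ (suc m) x) (Ψ (suc m) y)
Ψ-order m (S , neg) (T , neg) = ⇔-sym (Leq-∷ʳ-same S T false)
Ψ-order m (S , pos) (T , pos) = ⇔-sym (Leq-∷ʳ-same S T true)
Ψ-order m (S , pos) (T , neg) = mk⇔ (λ ()) (⊥-elim ∘ Leq-∷ʳ-true-false S T)
Ψ-order m (S , neg) (T , pos) = ⇔-sym (Leq-∷ʳ-false-true S T) ⇔-∘ DLeq-mixed m S T

-- The theorem; n ≥ 1 is needed since L_0^+ is empty, so (∅,-1) ⋠ (∅,1).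
proposition3p1 : (n : ℕ) → 1 ≤ n →
    Bijective {A = Double n} {B = _} _≡_ _≡_ (Ψ n)
    × ((x y : Double n) → DLeq n x y ⇔ Leq (suc n) (Ψ n x) (Ψ n y))
proposition3p1 (suc m) _ = Ψ-bijective (suc m) , Ψ-order m
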